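{- Let $M$ be a graph with a stable edge relation, and let $A,B\subseteq V(M)$. Then either there is a finite subset $S\subseteq A$ that dominates $B$, or there is a finite subset $S\subseteq B$ that antidominates $A$.
   Context: $M$ may be infinite. $M$ has a stable edge relation if there is $\ell$ such that $M$ has no vertices $a_1,\dots,a_\ell,b_1,\dots,b_\ell$ with $a_ib_j\in E(M)\iff i\le j$. A set $S$ dominates $B$ if every $b\in B$ has a neighbour in $S$; $S$ antidominates $A$ if every $a\in A$ has a non-neighbour in $S$. -}

module Defs where

open import Data.Nat using (ℕ)
open import Data.Fin using (Fin; _≤_)
open import Data.Product using (Σ; ∃; _×_)
open import Data.List using (List)
open import Data.List.Relation.Unary.All using (All)
open import Data.List.Relation.Unary.Any using (Any)
open import Relation.Nullary using (¬_)
open import Function.Bundles using (_⇔_)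

record Graph : Set₁ where
  field
    V     : Set
    E     : V → V → Set
    sym   : ∀ {x y} → E x y → E y x
    irrefl : ∀ {x} → ¬ E x x

module _ (M : Graph) where
  open Graph M

  HalfGraph : ℕ → Set
  HalfGraph ℓ = Σ (Fin ℓ → V) λ a → Σ (Fin ℓ → V) λ b →
                  ∀ i j → (E (a i) (b j) ⇔ (i ≤ j))

  StableEdgeRelation : Set
  StableEdgeRelation = ∃ λ ℓ → ¬ HalfGraph ℓ

  -- subsets of V as predicates; finite subsets as lists
  _⊆ₗ_ : List V → (V → Set) → Set
  S ⊆ₗ A = All A S

  Dominates : List V → (V → Set) → Set
  Dominates S B = ∀ b → B b → Any (λ s → E s b) S

  Antidominates : List V → (V → Set) → Set
  Antidominates S A = ∀ a → A a → Any (λ s → ¬ E a s) S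

{-# OPTIONS --safe #-}
-- Suppose no finite subset of A dominates B and no finite subset of B
-- antidominates A.  Then a half-graph a₁ … aₙ, b₁ … bₙ with aᵢ ∈ A and bⱼ ∈ B
-- extends to one of order n + 1: some b ∈ B is not dominated by {a₁ … aₙ},
-- and some a ∈ A is adjacent to all of b, b₁ … bₙ (otherwise {b, b₁ … bₙ}
-- would antidominate A); put a and b in front.  Half-graphs of every order
-- contradict stability.
module Submission where

open import Defs
open import Level using (0ℓ)
open import Axiom.ExcludedMiddle using (ExcludedMiddle)
open import Axiom.DoubleNegationElimination using (em⇒dne)
open import Data.Nat using (ℕ; zero; suc; z≤n; s≤s; s≤s⁻¹)
open import Data.Fin using (zero; suc; _≤_)
open import Data.List using (List; tabulate)
open import Data.List.Relation.Unary.All using (All)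
import Data.List.Relation.Unary.All.Properties as All
open import Data.List.Relation.Unary.Any using (Any)
open import Data.Product using (Σ; ∃; _×_; _,_)
open import Data.Sum using (_⊎_; inj₁; inj₂)
open import Data.Empty using (⊥-elim)
open import Data.Vec.Functional using (Vector; _∷_)
open import Function using (_∘_)
open import Function.Bundles using (_⇔_; mk⇔; Equivalence)
open import Relation.Nullary using (¬_; yes; no)

∷-pointwise : ∀ {X : Set} (P : X → Set) {n} {x : X} {xs : Vector X n} →
              P x → (∀ i → P (xs i)) → ∀ i → P ((x ∷ xs) i)
∷-pointwise P px pxs zero    = px
∷-pointwise P px pxs (suc i) = pxs i

module _ (em : ExcludedMiddle 0ℓ) {X Y : Set} where

  ¬∀Any⇒∃All¬ : {P : X → Set} {Q : X → Y → Set} {S : List Y} →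
                ¬ (∀ x → P x → Any (Q x) S) → ∃ λ x → P x × All (¬_ ∘ Q x) S
  ¬∀Any⇒∃All¬ {P} {Q} {S} ¬∀ with em {∃ λ x → P x × ¬ Any (Q x) S}
  ... | yes (x , px , ¬any) = x , px , All.¬Any⇒All¬ S ¬any
  ... | no ¬∃ = ⊥-elim (¬∀ λ x px → em⇒dne em λ ¬any → ¬∃ (x , px , ¬any))

module _ (M : Graph) where
  open Graph M

  IsHalfGraph : ∀ {n} → Vector V n → Vector V n → Set
  IsHalfGraph a b = ∀ i j → E (a i) (b j) ⇔ (i ≤ j)

  isHalfGraph-∷ : ∀ {n} {a b : Vector V n} {a′ b′ : V} → IsHalfGraph a b →
                  (∀ j → E a′ ((b′ ∷ b) j)) → (∀ i → ¬ E (a i) b′) →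
                  IsHalfGraph (a′ ∷ a) (b′ ∷ b)
  isHalfGraph-∷ h a′-adj b′-nonadj zero    j       = mk⇔ (λ _ → z≤n) (λ _ → a′-adj j)
  isHalfGraph-∷ h a′-adj b′-nonadj (suc i) zero    = mk⇔ (⊥-elim ∘ b′-nonadj i) λ ()
  isHalfGraph-∷ h a′-adj b′-nonadj (suc i) (suc j) =
    mk⇔ (s≤s ∘ Equivalence.to (h i j)) (Equivalence.from (h i j) ∘ s≤s⁻¹)

  record HalfGraphBetween (A B : V → Set) (n : ℕ) : Set where
    field
      left        : Vector V n
      right       : Vector V n
      left∈A      : ∀ i → A (left i)
      right∈B     : ∀ j → B (right j)
      isHalfGraph : IsHalfGraph left right

  module _ (em : ExcludedMiddle 0ℓ) {A B : V → Set}
           (¬dom : ¬ Σ (List V) λ S → _⊆ₗ_ M S A × Dominates M S B)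
           (¬anti : ¬ Σ (List V) λ S → _⊆ₗ_ M S B × Antidominates M S A) where

    undominatedBy : ∀ {n} (a : Vector V n) → (∀ i → A (a i)) →
                    ∃ λ b → B b × ∀ i → ¬ E (a i) b
    undominatedBy a a∈A
      with ¬∀Any⇒∃All¬ em (λ dom → ¬dom (tabulate a , All.tabulate⁺ a∈A , dom))
    ... | b , b∈B , nonadj = b , b∈B , All.tabulate⁻ nonadj

    adjacentToAll : ∀ {n} (b : Vector V n) → (∀ j → B (b j)) →
                    ∃ λ a → A a × ∀ j → E a (b j)
    adjacentToAll b b∈B
      with ¬∀Any⇒∃All¬ em (λ anti → ¬anti (tabulate b , All.tabulate⁺ b∈B , anti))
    ... | a , a∈A , ¬nonadj = a , a∈A , em⇒dne em ∘ All.tabulate⁻ ¬nonadj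

    halfGraphBetween : ∀ n → HalfGraphBetween A B n
    halfGraphBetween zero = record
      { left = λ () ; right = λ () ; left∈A = λ () ; right∈B = λ () ; isHalfGraph = λ () }
    halfGraphBetween (suc n) with halfGraphBetween n
    ... | record { left = a ; right = b ; left∈A = a∈A ; right∈B = b∈B ; isHalfGraph = h }
      with undominatedBy a a∈A
    ... | b′ , b′∈B , b′-nonadj with adjacentToAll (b′ ∷ b) (∷-pointwise B b′∈B b∈B)
    ... | a′ , a′∈A , a′-adj = record
      { left        = a′ ∷ a
      ; right       = b′ ∷ b
      ; left∈A      = ∷-pointwise A a′∈A a∈A
      ; right∈B     = ∷-pointwise B b′∈B b∈B
      ; isHalfGraph = isHalfGraph-∷ h a′-adj b′-nonadj
      }

mainTheorem18 : ExcludedMiddle 0ℓ → (M : Graph) → StableEdgeRelation M →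
    (A B : Graph.V M → Set) →
    (Σ (List (Graph.V M)) λ S → _⊆ₗ_ M S A × Dominates M S B)
    ⊎ (Σ (List (Graph.V M)) λ S → _⊆ₗ_ M S B × Antidominates M S A)
mainTheorem18 em M (ℓ , ¬halfGraph) A B
  with em {Σ (List (Graph.V M)) λ S → _⊆ₗ_ M S A × Dominates M S B}
... | yes dom = inj₁ dom
... | no ¬dom with em {Σ (List (Graph.V M)) λ S → _⊆ₗ_ M S B × Antidominates M S A}
... | yes anti = inj₂ anti
... | no ¬anti = ⊥-elim (¬halfGraph (left , right , isHalfGraph))
  where open HalfGraphBetween (halfGraphBetween M em ¬dom ¬anti ℓ)
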